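{- Let $r \ge 2$ and let $G = K_{n_1,n_2,\ldots,n_r}$ be the complete $r$-partite graph with parts of sizes $n_1 \ge n_2 \ge \cdots \ge n_r \ge 1$, let $n = n_1 + \cdots + n_r$, and let $\alpha$ be the number of indices $i$ for which $n_i$ is odd. If $3n_1 \le 2n$ and $3\alpha \le n$, then $\mathrm{ip}(G) = \lceil n/3 \rceil$.
   Context: An isometric path between two vertices of a graph is a shortest path joining them. The isometric path number $\mathrm{ip}(G)$ of a graph $G$ is the minimum number of isometric paths needed to cover all vertices of $G$. The complete $r$-partite graph $K_{n_1,\ldots,n_r}$ has vertex set partitioned into $r$ nonempty parts of sizes $n_1,\ldots,n_r$, with two vertices adjacent if and only if they lie in different parts. -}

module Defs where

open import Data.Nat using (ℕ; zero; suc; _+_; _*_; _≤_; _%_; _/_)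
open import Data.Fin using (Fin; zero; suc)
open import Data.Fin as F using ()
open import Data.Product using (Σ; _×_; ∃)
open import Data.List using (List; []; _∷_; length; head; last; tabulate)
open import Data.Nat.ListAction using (sum)
open import Data.List.Relation.Unary.All using (All)
open import Data.List.Relation.Unary.Any using (Any)
open import Data.List.Relation.Unary.Unique.Propositional using (Unique)
open import Data.List.Membership.Propositional using (_∈_)
open import Data.Unit using (⊤)
open import Relation.Binary.PropositionalEquality using (_≡_; _≢_)
open import Relation.Nullary using (¬_)

module _ {V : Set} (Adj : V → V → Set) where

  IsWalk : List V → Set
  IsWalk []           = ⊤
  IsWalk (x ∷ [])     = ⊤
  IsWalk (x ∷ y ∷ xs) = Adj x y × IsWalk (y ∷ xs)

  record IsPath (p : List V) : Set where
    field
      nonempty : p ≢ []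
      walk     : IsWalk p
      distinct : Unique p

  record IsIsometricPath (p : List V) : Set where
    field
      path     : IsPath p
      shortest : ∀ (q : List V) → IsWalk q → head q ≡ head p → last q ≡ last p →
                 length p ≤ length q

  IsometricPathCover : ℕ → Set
  IsometricPathCover k =
    Σ (List (List V)) λ ps →
      (length ps ≡ k) × All IsIsometricPath ps × (∀ (v : V) → Any (v ∈_) ps)

  IsometricPathNumber : ℕ → Set
  IsometricPathNumber m =
    IsometricPathCover m × (∀ (k : ℕ) → IsometricPathCover k → m ≤ k)

-- Complete multipartite graph K_{sizes 0, ..., sizes (r-1)}:
-- vertex (i , a) is the a-th vertex of part i; adjacent iff parts differ.

KVertex : (r : ℕ) → (Fin r → ℕ) → Set
KVertex r sizes = Σ (Fin r) (λ i → Fin (sizes i))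

KAdj : (r : ℕ) (sizes : Fin r → ℕ) → KVertex r sizes → KVertex r sizes → Set
KAdj r sizes (i Data.Product., _) (j Data.Product., _) = i ≢ j

totalSize : (r : ℕ) → (Fin r → ℕ) → ℕ
totalSize r sizes = sum (tabulate sizes)

oddCount : (r : ℕ) → (Fin r → ℕ) → ℕ
oddCount zero    sizes = 0
oddCount (suc r) sizes with sizes zero % 2
... | 1 = suc (oddCount r (λ i → sizes (suc i)))
... | _ = oddCount r (λ i → sizes (suc i))

ceilDiv3 : ℕ → ℕ
ceilDiv3 n = (n + 2) / 3

-- A complete multipartite graph with at least two parts has diameter 2, so its isometric paths have at
-- most three vertices and at least ⌈n/3⌉ of them are needed to cover the n vertices. For a cover of that
-- size, proceed greedily: while at least three vertices are uncovered, cover two uncovered vertices of a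
-- largest part together with one of another part (odd-sized if possible) by a path x–z–y, which is
-- isometric because x and y are non-adjacent. The last one or two vertices lie on one isometric path.
module Submission where

open import Defs
open import Data.Nat using (ℕ; zero; suc; pred; _+_; _*_; _∸_; _%_; _/_; _≤_; _<_; z≤n; s≤s; z<s; >-nonZero)
import Data.Nat as ℕ using (_≟_)
open import Data.Nat.Properties hiding (_≟_)
open import Data.Nat.DivMod
  using (m%n<n; m%n≤m; m<n⇒m%n≡m; %-distribˡ-+; m%n%n≡m%n; m/n≡1+[m∸n]/n; m<n*o⇒m/o<n; m/n*n≤m; m≡m%n+[m/n]*n)
open import Data.Nat.ListAction using (sum)
open import Data.Nat.Tactic.RingSolver using (solve-∀)
open import Data.Fin using (Fin; zero; suc; toℕ; fromℕ<; splitAt; join; _≟_)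
open import Data.Fin as F using ()
open import Data.Fin.Properties using (any?; injective⇒≤; join-splitAt; toℕ-fromℕ<; toℕ-injective; toℕ<n)
open import Data.List using (List; []; _∷_; _++_; length; head; last; concat; allFin)
open import Data.List.Properties using (tabulate-cong; length-++)
open import Data.List.Extrema.Nat using (argmax; f[xs]≤f[argmax])
open import Data.List.Relation.Unary.All as All using (All; []; _∷_)
open import Data.List.Relation.Unary.AllPairs using ([]; _∷_)
open import Data.List.Relation.Unary.Any using (Any; here; there)
open import Data.List.Membership.Propositional using (_∈_)
open import Data.List.Membership.Propositional.Properties using (∈-allFin; ∈-concat⁺)
open import Data.List.Membership.Setoid.Properties using (index-injective)
open import Data.Maybe using (just)
open import Data.Maybe.Properties using (just-injective)
open import Data.Product using (Σ; ∃; ∃₂; _×_; _,_; proj₁; proj₂)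
open import Data.Product.Properties using (≡-dec)
open import Data.Sum using (_⊎_; inj₁; inj₂; [_,_]′)
open import Data.Unit using (tt)
open import Data.Empty using (⊥-elim)
open import Data.Vec.Functional using (updateAt)
open import Data.Vec.Functional.Properties using (updateAt-updates; updateAt-minimal)
open import Function using (_∘_)
open import Function.Definitions using (Injective)
open import Relation.Nullary using (¬_; yes; no; ¬?; _×-dec_)
open import Relation.Binary.PropositionalEquality
  using (_≡_; _≢_; refl; sym; trans; cong; cong₂; subst; subst₂; setoid; module ≡-Reasoning)

private
  variable
    A V : Set
    R m t : ℕ

totalSize-cong : {c d : Fin R → ℕ} → (∀ k → c k ≡ d k) → totalSize R c ≡ totalSize R d
totalSize-cong c≗d = cong sum (tabulate-cong c≗d)

totalSize-mono-≤ : {c d : Fin R → ℕ} → (∀ k → c k ≤ d k) → totalSize R c ≤ totalSize R d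
totalSize-mono-≤ {zero}  c≤d = z≤n
totalSize-mono-≤ {suc R} c≤d = +-mono-≤ (c≤d zero) (totalSize-mono-≤ (c≤d ∘ suc))

totalSize-zero : {c : Fin R → ℕ} → (∀ k → c k ≡ 0) → totalSize R c ≡ 0
totalSize-zero {zero}  c≡0 = refl
totalSize-zero {suc R} c≡0 = cong₂ _+_ (c≡0 zero) (totalSize-zero (c≡0 ∘ suc))

totalSize-except : (i : Fin R) {c d : Fin R → ℕ} → (∀ k → k ≢ i → c k ≡ d k) →
                   totalSize R c + d i ≡ totalSize R d + c i
totalSize-except {suc R} zero {c} {d} c≡d
  rewrite totalSize-cong {c = c ∘ suc} {d ∘ suc} (λ k → c≡d (suc k) λ ())
  = swap (c zero) (totalSize R (d ∘ suc)) (d zero)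
  where
  swap : ∀ a b c → a + b + c ≡ c + b + a
  swap = solve-∀
totalSize-except {suc R} (suc i) {c} {d} c≡d = begin
  c zero + totalSize R (c ∘ suc) + d (suc i)    ≡⟨ +-assoc (c zero) _ _ ⟩
  c zero + (totalSize R (c ∘ suc) + d (suc i))  ≡⟨ cong₂ _+_ (c≡d zero λ ()) tails ⟩
  d zero + (totalSize R (d ∘ suc) + c (suc i))  ≡⟨ +-assoc (d zero) _ _ ⟨
  d zero + totalSize R (d ∘ suc) + c (suc i)    ∎
  where
  open ≡-Reasoning
  tails : totalSize R (c ∘ suc) + d (suc i) ≡ totalSize R (d ∘ suc) + c (suc i)
  tails = totalSize-except i λ k k≢i → c≡d (suc k) λ { refl → k≢i refl }

totalSize-single : (i : Fin R) {c : Fin R → ℕ} → (∀ k → k ≢ i → c k ≡ 0) → totalSize R c ≡ c i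
totalSize-single {R} i {c} c≡0 = begin
  totalSize R c                ≡⟨ +-identityʳ _ ⟨
  totalSize R c + 0            ≡⟨ totalSize-except i {d = λ _ → 0} c≡0 ⟩
  totalSize R (λ _ → 0) + c i  ≡⟨ cong (_+ c i) (totalSize-zero {R} λ _ → refl) ⟩
  c i                          ∎
  where open ≡-Reasoning

entry≤totalSize : (c : Fin R → ℕ) (k : Fin R) → c k ≤ totalSize R c
entry≤totalSize c zero    = m≤m+n _ _
entry≤totalSize c (suc k) = ≤-trans (entry≤totalSize (c ∘ suc) k) (m≤n+m _ (c zero))

entry+entry≤totalSize : (c : Fin R → ℕ) {k l : Fin R} → k ≢ l → c k + c l ≤ totalSize R c
entry+entry≤totalSize c {zero}  {zero}  0≢0 = ⊥-elim (0≢0 refl)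
entry+entry≤totalSize c {zero}  {suc l} _   = +-monoʳ-≤ (c zero) (entry≤totalSize (c ∘ suc) l)
entry+entry≤totalSize c {suc k} {zero}  _   =
  ≤-trans (≤-reflexive (+-comm (c (suc k)) (c zero))) (+-monoʳ-≤ (c zero) (entry≤totalSize (c ∘ suc) k))
entry+entry≤totalSize c {suc k} {suc l} k≢l =
  ≤-trans (entry+entry≤totalSize (c ∘ suc) (k≢l ∘ cong suc)) (m≤n+m _ (c zero))

positive-entry : (c : Fin R → ℕ) → 0 < totalSize R c → ∃₂ λ k m → c k ≡ suc m
positive-entry {suc R} c 0<Σ with c zero in c₀
... | suc m = zero , m , c₀
... | zero  = let k , m , cₖ = positive-entry (c ∘ suc) 0<Σ in suc k , m , cₖ

oddParts : (Fin R → ℕ) → ℕ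
oddParts {R} c = totalSize R (λ k → c k % 2)

oddCount≡oddParts : (c : Fin R → ℕ) → oddCount R c ≡ oddParts c
oddCount≡oddParts {zero}  c = refl
oddCount≡oddParts {suc R} c with c zero % 2 | m%n<n (c zero) 2
... | 0           | _             = oddCount≡oddParts (c ∘ suc)
... | 1           | _             = cong suc (oddCount≡oddParts (c ∘ suc))
... | suc (suc _) | s≤s (s≤s ())

oddParts≤totalSize : (c : Fin R → ℕ) → oddParts c ≤ totalSize R c
oddParts≤totalSize c = totalSize-mono-≤ (λ k → m%n≤m (c k) 2)

oddParts≡totalSize : (c : Fin R → ℕ) → (∀ k → c k ≤ 1) → oddParts c ≡ totalSize R c
oddParts≡totalSize c c≤1 = totalSize-cong (λ k → m<n⇒m%n≡m (s≤s (c≤1 k)))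

oddParts-%2 : (c : Fin R → ℕ) → oddParts c % 2 ≡ totalSize R c % 2
oddParts-%2 {zero}  c = refl
oddParts-%2 {suc R} c = begin
  (c zero % 2 + oddParts (c ∘ suc)) % 2          ≡⟨ %-distribˡ-+ (c zero % 2) _ 2 ⟩
  (c zero % 2 % 2 + oddParts (c ∘ suc) % 2) % 2  ≡⟨ cong₂ (λ a b → (a + b) % 2) (m%n%n≡m%n (c zero) 2)
                                                                               (oddParts-%2 (c ∘ suc)) ⟩
  (c zero % 2 + totalSize R (c ∘ suc) % 2) % 2   ≡⟨ %-distribˡ-+ (c zero) _ 2 ⟨
  (c zero + totalSize R (c ∘ suc)) % 2           ∎
  where open ≡-Reasoning

[1+n]%2+n%2≡1 : ∀ n → suc n % 2 + n % 2 ≡ 1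
[1+n]%2+n%2≡1 zero          = refl
[1+n]%2+n%2≡1 (suc zero)    = refl
[1+n]%2+n%2≡1 (suc (suc n)) = [1+n]%2+n%2≡1 n

n%2≢1⇒n%2≡0 : ∀ n → n % 2 ≢ 1 → n % 2 ≡ 0
n%2≢1⇒n%2≡0 zero          _   = refl
n%2≢1⇒n%2≡0 (suc zero)    odd = ⊥-elim (odd refl)
n%2≢1⇒n%2≡0 (suc (suc n))     = n%2≢1⇒n%2≡0 n

removeTop : Fin R → (Fin R → ℕ) → Fin R → ℕ
removeTop k c = updateAt c k pred

removeTop-at : (k : Fin R) (c : Fin R → ℕ) → c k ≡ suc m → removeTop k c k ≡ m
removeTop-at k c cₖ = trans (updateAt-updates k {pred} c) (cong pred cₖ)

removeTop-other : (k : Fin R) (c : Fin R → ℕ) {l : Fin R} → l ≢ k → removeTop k c l ≡ c l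
removeTop-other k c {l} = updateAt-minimal l k c

removeTop-≤ : (k : Fin R) (c : Fin R → ℕ) (l : Fin R) → removeTop k c l ≤ c l
removeTop-≤ k c l with l ≟ k
... | yes refl = ≤-trans (≤-reflexive (updateAt-updates k {pred} c)) pred[n]≤n
... | no l≢k   = ≤-reflexive (removeTop-other k c l≢k)

totalSize-removeTop : (k : Fin R) (c : Fin R → ℕ) → c k ≡ suc m →
                      suc (totalSize R (removeTop k c)) ≡ totalSize R c
totalSize-removeTop {R} {m} k c cₖ = +-cancelʳ-≡ m _ _ (begin
  suc (totalSize R (removeTop k c)) + m  ≡⟨ +-suc _ m ⟨
  totalSize R (removeTop k c) + suc m    ≡⟨ cong (totalSize R (removeTop k c) +_) cₖ ⟨
  totalSize R (removeTop k c) + c k      ≡⟨ totalSize-except k (λ l → removeTop-other k c) ⟩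
  totalSize R c + removeTop k c k        ≡⟨ cong (totalSize R c +_) (removeTop-at k c cₖ) ⟩
  totalSize R c + m                      ∎)
  where open ≡-Reasoning

oddParts-removeTop : (k : Fin R) (c : Fin R → ℕ) →
                     oddParts (removeTop k c) + c k % 2 ≡ oddParts c + pred (c k) % 2
oddParts-removeTop k c =
  trans (totalSize-except k (λ l → cong (_% 2) ∘ removeTop-other k c))
        (cong (λ x → oddParts c + x % 2) (updateAt-updates k {pred} c))

oddParts-removeTop-odd : (k : Fin R) (c : Fin R → ℕ) → c k ≡ suc m → c k % 2 ≡ 1 →
                         suc (oddParts (removeTop k c)) ≡ oddParts c
oddParts-removeTop-odd {m = m} k c cₖ odd = begin
  suc (oddParts (removeTop k c))      ≡⟨ +-comm 1 _ ⟩
  oddParts (removeTop k c) + 1        ≡⟨ cong (oddParts (removeTop k c) +_) odd ⟨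
  oddParts (removeTop k c) + c k % 2  ≡⟨ oddParts-removeTop k c ⟩
  oddParts c + pred (c k) % 2         ≡⟨ cong (λ x → oddParts c + pred x % 2) cₖ ⟩
  oddParts c + m % 2                  ≡⟨ cong (oddParts c +_) m-even ⟩
  oddParts c + 0                      ≡⟨ +-identityʳ _ ⟩
  oddParts c                          ∎
  where
  open ≡-Reasoning
  m-even : m % 2 ≡ 0
  m-even = +-cancelˡ-≡ 1 _ _ (begin
    1 + m % 2          ≡⟨ cong (_+ m % 2) (trans (cong (_% 2) (sym cₖ)) odd) ⟨
    suc m % 2 + m % 2  ≡⟨ [1+n]%2+n%2≡1 m ⟩
    1                  ∎)

oddParts-removeTop-≤ : (k : Fin R) (c : Fin R → ℕ) → oddParts (removeTop k c) ≤ suc (oddParts c)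
oddParts-removeTop-≤ k c = begin
  oddParts (removeTop k c)            ≤⟨ m≤m+n _ _ ⟩
  oddParts (removeTop k c) + c k % 2  ≡⟨ oddParts-removeTop k c ⟩
  oddParts c + pred (c k) % 2         ≤⟨ +-monoʳ-≤ (oddParts c) (≤-pred (m%n<n (pred (c k)) 2)) ⟩
  oddParts c + 1                      ≡⟨ +-comm _ 1 ⟩
  suc (oddParts c)                    ∎
  where open ≤-Reasoning

oddParts-removeTop² : (k : Fin R) (c : Fin R → ℕ) → c k ≡ suc (suc m) →
                      oddParts (removeTop k (removeTop k c)) ≡ oddParts c
oddParts-removeTop² k c cₖ = totalSize-cong same-parity
  where
  same-parity : ∀ l → removeTop k (removeTop k c) l % 2 ≡ c l % 2
  same-parity l with l ≟ k
  ... | yes refl = trans (cong (_% 2) (removeTop-at k _ (removeTop-at k c cₖ))) (cong (_% 2) (sym cₖ))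
  ... | no l≢k   = cong (_% 2) (trans (removeTop-other k _ l≢k) (removeTop-other k c l≢k))

2*m≤2*n+1⇒m≤n : ∀ {m n} → 2 * m ≤ 2 * n + 1 → m ≤ n
2*m≤2*n+1⇒m≤n {m} {n} 2m≤2n+1 =
  ≤-pred (*-cancelˡ-< 2 m (suc n) (≤-trans (s≤s 2m≤2n+1) (≤-reflexive (regroup n))))
  where
  regroup : ∀ n → suc (2 * n + 1) ≡ 2 * suc n
  regroup = solve-∀

paired-bound : ∀ {x y n} t → x ≤ y + 2 → x + y ≤ n → 3 * t ≤ n → x + t ≤ n
paired-bound {x} {y} {n} zero _ x+y≤n _ = begin
  x + 0  ≡⟨ +-identityʳ x ⟩
  x      ≤⟨ m≤m+n x y ⟩
  x + y  ≤⟨ x+y≤n ⟩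
  n      ∎
  where open ≤-Reasoning
paired-bound {x} {y} {n} (suc t) x≤y+2 x+y≤n 3t≤n = 2*m≤2*n+1⇒m≤n (begin
  2 * (x + suc t)          ≡⟨ regroup₁ x t ⟩
  x + x + 2 * suc t        ≤⟨ +-monoˡ-≤ (2 * suc t) (+-monoʳ-≤ x x≤y+2) ⟩
  x + (y + 2) + 2 * suc t  ≡⟨ regroup₂ x y t ⟩
  (x + y) + (2 * t + 4)    ≤⟨ +-mono-≤ x+y≤n (+-monoˡ-≤ 4 (*-monoˡ-≤ t {2} {3} (s≤s (s≤s z≤n)))) ⟩
  n + (3 * t + 4)          ≡⟨ cong (n +_) (regroup₃ t) ⟩
  n + (3 * suc t + 1)      ≤⟨ +-monoʳ-≤ n (+-monoˡ-≤ 1 3t≤n) ⟩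
  n + (n + 1)              ≡⟨ regroup₄ n ⟩
  2 * n + 1                ∎)
  where
  open ≤-Reasoning
  regroup₁ : ∀ x t → 2 * (x + suc t) ≡ x + x + 2 * suc t
  regroup₁ = solve-∀
  regroup₂ : ∀ x y t → x + (y + 2) + 2 * suc t ≡ (x + y) + (2 * t + 4)
  regroup₂ = solve-∀
  regroup₃ : ∀ t → 3 * t + 4 ≡ 3 * suc t + 1
  regroup₃ = solve-∀
  regroup₄ : ∀ n → n + (n + 1) ≡ 2 * n + 1
  regroup₄ = solve-∀

parity-bound : ∀ {a n} t → a ≤ 2 → a ≤ n → a % 2 ≡ n % 2 → 3 * t ≤ n → a + 2 * t ≤ n
parity-bound {a} zero _ a≤n _ _ = ≤-trans (≤-reflexive (+-identityʳ a)) a≤n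
parity-bound (suc zero) z≤n             _ _  (s≤s (s≤s (s≤s _)))             = s≤s (s≤s z≤n)
parity-bound (suc zero) (s≤s z≤n)       _ _  (s≤s (s≤s (s≤s _)))             = s≤s (s≤s (s≤s z≤n))
parity-bound (suc zero) (s≤s (s≤s z≤n)) _ () (s≤s (s≤s (s≤s {n = zero} _)))
parity-bound (suc zero) (s≤s (s≤s z≤n)) _ _  (s≤s (s≤s (s≤s {n = suc _} _))) = s≤s (s≤s (s≤s (s≤s z≤n)))
parity-bound {a} {n} (suc (suc t)) a≤2 _ _ 3t≤n = begin
  a + 2 * suc (suc t)  ≤⟨ +-monoˡ-≤ _ a≤2 ⟩
  2 + 2 * suc (suc t)  ≡⟨ regroup₁ t ⟩
  6 + 2 * t            ≤⟨ +-monoʳ-≤ 6 (*-monoˡ-≤ t {2} {3} (s≤s (s≤s z≤n))) ⟩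
  6 + 3 * t            ≡⟨ regroup₂ t ⟩
  3 * suc (suc t)      ≤⟨ 3t≤n ⟩
  n                    ∎
  where
  open ≤-Reasoning
  regroup₁ : ∀ t → 2 + 2 * suc (suc t) ≡ 6 + 2 * t
  regroup₁ = solve-∀
  regroup₂ : ∀ t → 6 + 3 * t ≡ 3 * suc (suc t)
  regroup₂ = solve-∀

ceilDiv3-3+ : ∀ n → ceilDiv3 (3 + n) ≡ suc (ceilDiv3 n)
ceilDiv3-3+ n = m/n≡1+[m∸n]/n {3 + n + 2} {3} (s≤s (s≤s (s≤s z≤n)))

ceilDiv3-least : ∀ {n k} → n ≤ 3 * k → ceilDiv3 n ≤ k
ceilDiv3-least {n} {k} n≤3k = ≤-pred (m<n*o⇒m/o<n (begin-strict
  n + 2            <⟨ +-monoˡ-< 2 (s≤s n≤3k) ⟩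
  suc (3 * k) + 2  ≡⟨ regroup k ⟩
  suc k * 3        ∎))
  where
  open ≤-Reasoning
  regroup : ∀ k → suc (3 * k) + 2 ≡ suc k * 3
  regroup = solve-∀

3*[n/3]≤n : ∀ n → 3 * (n / 3) ≤ n
3*[n/3]≤n n = subst (_≤ n) (*-comm (n / 3) 3) (m/n*n≤m n 3)

n≡3*[n/3]+n%3 : ∀ n → n ≡ 3 * (n / 3) + n % 3
n≡3*[n/3]+n%3 n =
  trans (m≡m%n+[m/n]*n n 3) (trans (+-comm (n % 3) _) (cong (_+ n % 3) (*-comm (n / 3) 3)))

-- The greedy step

-- With 3t + e uncovered vertices these read c k ≤ 2t + e and α ≤ t + e: the hypotheses 3 n₁ ≤ 2 n and
-- 3 α ≤ n of the theorem, weakened just enough to survive the removal of a path.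
record Balanced (t : ℕ) (c : Fin R → ℕ) : Set where
  field
    part-bound : ∀ k → c k + t ≤ totalSize R c
    odd-bound  : oddParts c + 2 * t ≤ totalSize R c

balanced-initial : (c : Fin R → ℕ) → (∀ k → 3 * c k ≤ 2 * totalSize R c) →
                   3 * oddParts c ≤ totalSize R c → Balanced (totalSize R c / 3) c
balanced-initial {R} c 3c≤2n 3o≤n = record
  { part-bound = λ k → *-cancelˡ-≤ 3 (begin
      3 * (c k + n / 3)                   ≡⟨ *-distribˡ-+ 3 (c k) (n / 3) ⟩
      3 * c k + 3 * (n / 3)               ≤⟨ +-mono-≤ (3c≤2n k) (3*[n/3]≤n n) ⟩
      2 * n + n                           ≡⟨ regroup₁ n ⟩
      3 * n                               ∎)
  ; odd-bound = *-cancelˡ-≤ 3 (begin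
      3 * (oddParts c + 2 * (n / 3))      ≡⟨ regroup₂ (oddParts c) (n / 3) ⟩
      3 * oddParts c + 2 * (3 * (n / 3))  ≤⟨ +-mono-≤ 3o≤n (*-monoʳ-≤ 2 (3*[n/3]≤n n)) ⟩
      n + 2 * n                           ≡⟨ regroup₃ n ⟩
      3 * n                               ∎)
  }
  where
  open ≤-Reasoning
  n : ℕ
  n = totalSize R c
  regroup₁ : ∀ n → 2 * n + n ≡ 3 * n
  regroup₁ = solve-∀
  regroup₂ : ∀ o t → 3 * (o + 2 * t) ≡ 3 * o + 2 * (3 * t)
  regroup₂ = solve-∀
  regroup₃ : ∀ n → n + 2 * n ≡ 3 * n
  regroup₃ = solve-∀

-- Taking j odd whenever possible lowers α; otherwise α ≤ 1 before the step and α ≤ 2 after it.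
record Choice (c : Fin R → ℕ) : Set where
  field
    i j                : Fin R
    a b                : ℕ
    cᵢ                 : c i ≡ 2 + a
    cⱼ                 : c j ≡ 1 + b
    j≢i                : j ≢ i
    i-largest          : ∀ k → c k ≤ c i
    j-odd-or-rest-even : c j % 2 ≡ 1 ⊎ (∀ k → k ≢ i → c k % 2 ≡ 0)

largest-part : (c : Fin (suc R) → ℕ) → ∃ λ i → ∀ k → c k ≤ c i
largest-part c =
  argmax c zero (allFin _) , λ k → All.lookup (f[xs]≤f[argmax] {f = c} zero (allFin _)) (∈-allFin k)

largest-part-≥2 : {c : Fin R → ℕ} (i : Fin R) → (∀ k → c k ≤ c i) → Balanced (suc t) c →
                  ∃ λ a → c i ≡ 2 + a
largest-part-≥2 {c = c} i i-largest balanced with c i ≤? 1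
... | no cᵢ≰1  = c i ∸ 2 , sym (m+[n∸m]≡n (≰⇒> cᵢ≰1))
... | yes cᵢ≤1 = ⊥-elim (m+1+n≰m (oddParts c) (subst (oddParts c + _ ≤_) all-odd (Balanced.odd-bound balanced)))
  where
  all-odd : totalSize _ c ≡ oddParts c
  all-odd = sym (oddParts≡totalSize c λ k → ≤-trans (i-largest k) cᵢ≤1)

nonempty-other-part : {c : Fin R → ℕ} (i : Fin R) → Balanced (suc t) c → ∃ λ j → j ≢ i × 0 < c j
nonempty-other-part {c = c} i balanced with any? (λ k → ¬? (k ≟ i) ×-dec (0 <? c k))
... | yes found = found
... | no none   = ⊥-elim (m+1+n≰m (c i) (subst (c i + _ ≤_) (totalSize-single i others-empty)
                                                            (Balanced.part-bound balanced i)))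
  where
  others-empty : ∀ k → k ≢ i → c k ≡ 0
  others-empty k k≢i = n≤0⇒n≡0 (≮⇒≥ λ 0<cₖ → none (k , k≢i , 0<cₖ))

second-part : {c : Fin R → ℕ} (i : Fin R) → Balanced (suc t) c →
              ∃ λ j → j ≢ i × 0 < c j × (c j % 2 ≡ 1 ⊎ (∀ k → k ≢ i → c k % 2 ≡ 0))
second-part {c = c} i balanced with any? (λ k → ¬? (k ≟ i) ×-dec (c k % 2 ℕ.≟ 1))
... | yes (j , j≢i , odd) = j , j≢i , n≢0⇒n>0 (λ cⱼ≡0 → 0≢1+n (trans (cong (_% 2) (sym cⱼ≡0)) odd)) , inj₁ odd
... | no none =
  let j , j≢i , 0<cⱼ = nonempty-other-part i balanced
  in j , j≢i , 0<cⱼ , inj₂ λ k k≢i → n%2≢1⇒n%2≡0 (c k) λ odd → none (k , k≢i , odd)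

choose : {c : Fin (suc R) → ℕ} → Balanced (suc t) c → Choice c
choose {c = c} balanced =
  let i , i-largest           = largest-part c
      a , cᵢ                  = largest-part-≥2 i i-largest balanced
      j , j≢i , 0<cⱼ , parity = second-part i balanced
  in record { i = i ; j = j ; a = a ; b = pred (c j) ; cᵢ = cᵢ
            ; cⱼ = sym (suc-pred (c j) {{>-nonZero 0<cⱼ}}) ; j≢i = j≢i
            ; i-largest = i-largest ; j-odd-or-rest-even = parity }

module Step {R : ℕ} {c : Fin R → ℕ} (choice : Choice c) where

  open Choice choice

  c₁ c₂ c₃ : Fin R → ℕ
  c₁ = removeTop i c
  c₂ = removeTop i c₁
  c₃ = removeTop j c₂

  c₁ᵢ : c₁ i ≡ suc a
  c₁ᵢ = removeTop-at i c cᵢ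

  c₂ⱼ : c₂ j ≡ suc b
  c₂ⱼ = trans (removeTop-other i c₁ j≢i) (trans (removeTop-other i c j≢i) cⱼ)

  c₃ᵢ : c₃ i ≡ a
  c₃ᵢ = trans (removeTop-other j c₂ (j≢i ∘ sym)) (removeTop-at i c₁ c₁ᵢ)

  c₃≤c : ∀ k → c₃ k ≤ c k
  c₃≤c k = ≤-trans (removeTop-≤ j c₂ k) (≤-trans (removeTop-≤ i c₁ k) (removeTop-≤ i c k))

  totalSize-c₃ : 3 + totalSize R c₃ ≡ totalSize R c
  totalSize-c₃ = begin
    3 + totalSize R c₃  ≡⟨ cong (2 +_) (totalSize-removeTop j c₂ c₂ⱼ) ⟩
    2 + totalSize R c₂  ≡⟨ cong suc (totalSize-removeTop i c₁ c₁ᵢ) ⟩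
    1 + totalSize R c₁  ≡⟨ totalSize-removeTop i c cᵢ ⟩
    totalSize R c       ∎
    where open ≡-Reasoning

  part-bound-c₃ : Balanced (suc t) c → 3 * t ≤ totalSize R c₃ → ∀ k → c₃ k + t ≤ totalSize R c₃
  part-bound-c₃ {t} balanced 3t≤n k with k ≟ i
  ... | yes refl = +-cancelˡ-≤ 3 _ _ (begin
    3 + (c₃ i + t)      ≡⟨ cong (λ x → 3 + (x + t)) c₃ᵢ ⟩
    3 + (a + t)         ≡⟨ regroup a t ⟩
    2 + a + suc t       ≡⟨ cong (_+ suc t) cᵢ ⟨
    c i + suc t         ≤⟨ Balanced.part-bound balanced i ⟩
    totalSize R c       ≡⟨ totalSize-c₃ ⟨
    3 + totalSize R c₃  ∎)
    where
    open ≤-Reasoning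
    regroup : ∀ a t → 3 + (a + t) ≡ 2 + a + suc t
    regroup = solve-∀
  ... | no k≢i = paired-bound t c₃ₖ≤c₃ᵢ+2 (entry+entry≤totalSize c₃ k≢i) 3t≤n
    where
    open ≤-Reasoning
    c₃ₖ≤c₃ᵢ+2 : c₃ k ≤ c₃ i + 2
    c₃ₖ≤c₃ᵢ+2 = begin
      c₃ k      ≤⟨ c₃≤c k ⟩
      c k       ≤⟨ i-largest k ⟩
      c i       ≡⟨ cᵢ ⟩
      2 + a     ≡⟨ +-comm 2 a ⟩
      a + 2     ≡⟨ cong (_+ 2) c₃ᵢ ⟨
      c₃ i + 2  ∎

  odd-bound-c₃ : Balanced (suc t) c → 3 * t ≤ totalSize R c₃ → oddParts c₃ + 2 * t ≤ totalSize R c₃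
  odd-bound-c₃ {t} balanced 3t≤n with j-odd-or-rest-even
  ... | inj₁ j-odd = +-cancelˡ-≤ 3 _ _ (begin
    3 + (oddParts c₃ + 2 * t)      ≡⟨ regroup (oddParts c₃) t ⟩
    suc (oddParts c₃) + 2 * suc t  ≡⟨ cong (_+ 2 * suc t) (oddParts-removeTop-odd j c₂ c₂ⱼ c₂ⱼ-odd) ⟩
    oddParts c₂ + 2 * suc t        ≡⟨ cong (_+ 2 * suc t) (oddParts-removeTop² i c cᵢ) ⟩
    oddParts c + 2 * suc t         ≤⟨ Balanced.odd-bound balanced ⟩
    totalSize R c                  ≡⟨ totalSize-c₃ ⟨
    3 + totalSize R c₃             ∎)
    where
    open ≤-Reasoning
    regroup : ∀ o t → 3 + (o + 2 * t) ≡ suc o + 2 * suc t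
    regroup = solve-∀
    c₂ⱼ-odd : c₂ j % 2 ≡ 1
    c₂ⱼ-odd = trans (cong (_% 2) (trans c₂ⱼ (sym cⱼ))) j-odd
  ... | inj₂ rest-even = parity-bound t few-odd (oddParts≤totalSize c₃) (oddParts-%2 c₃) 3t≤n
    where
    open ≤-Reasoning
    few-odd : oddParts c₃ ≤ 2
    few-odd = begin
      oddParts c₃        ≤⟨ oddParts-removeTop-≤ j c₂ ⟩
      suc (oddParts c₂)  ≡⟨ cong suc (oddParts-removeTop² i c cᵢ) ⟩
      suc (oddParts c)   ≡⟨ cong suc (totalSize-single i rest-even) ⟩
      suc (c i % 2)      ≤⟨ s≤s (≤-pred (m%n<n (c i) 2)) ⟩
      2                  ∎

  balanced-c₃ : Balanced (suc t) c → 3 * t ≤ totalSize R c₃ → Balanced t c₃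
  balanced-c₃ balanced 3t≤n = record
    { part-bound = part-bound-c₃ balanced 3t≤n
    ; odd-bound  = odd-bound-c₃ balanced 3t≤n
    }

-- Isometric paths

last-∷ : (x : A) (xs : List A) → ∃ λ y → last (x ∷ xs) ≡ just y
last-∷ x []       = x , refl
last-∷ x (y ∷ xs) = last-∷ y xs

module _ {Adj : V → V → Set} {x y : V} where

  walk-≢⇒2≤length : x ≢ y → ∀ q → IsWalk Adj q → head q ≡ just x → last q ≡ just y → 2 ≤ length q
  walk-≢⇒2≤length x≢y []          _ () _
  walk-≢⇒2≤length x≢y (_ ∷ [])    _ hd lt = ⊥-elim (x≢y (trans (sym (just-injective hd)) (just-injective lt)))
  walk-≢⇒2≤length x≢y (_ ∷ _ ∷ _) _ _  _  = s≤s (s≤s z≤n)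

  walk-≁⇒3≤length : x ≢ y → ¬ Adj x y → ∀ q → IsWalk Adj q → head q ≡ just x → last q ≡ just y → 3 ≤ length q
  walk-≁⇒3≤length _   _   []              _         () _
  walk-≁⇒3≤length x≢y _   (_ ∷ [])        _         hd lt = ⊥-elim (x≢y (trans (sym (just-injective hd))
                                                                                  (just-injective lt)))
  walk-≁⇒3≤length _   x≁y (_ ∷ _ ∷ [])    (a~b , _) hd lt
    rewrite just-injective hd | just-injective lt = ⊥-elim (x≁y a~b)
  walk-≁⇒3≤length _   _   (_ ∷ _ ∷ _ ∷ _) _         _  _  = s≤s (s≤s (s≤s z≤n))

module _ {Adj : V → V → Set} where

  singleton-isometric : (x : V) → IsIsometricPath Adj (x ∷ [])
  singleton-isometric x = record
    { path     = record { nonempty = λ () ; walk = tt ; distinct = [] ∷ [] }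
    ; shortest = λ { (_ ∷ _) _ _ _ → s≤s z≤n }
    }

  edge-isometric : {x y : V} → x ≢ y → Adj x y → IsIsometricPath Adj (x ∷ y ∷ [])
  edge-isometric x≢y x~y = record
    { path     = record { nonempty = λ () ; walk = x~y , tt ; distinct = (x≢y ∷ []) ∷ [] ∷ [] }
    ; shortest = walk-≢⇒2≤length x≢y
    }

  geodesic-isometric : {x z y : V} → Adj x z → Adj z y → x ≢ z → z ≢ y → x ≢ y → ¬ Adj x y →
                       IsIsometricPath Adj (x ∷ z ∷ y ∷ [])
  geodesic-isometric x~z z~y x≢z z≢y x≢y x≁y = record
    { path     = record { nonempty = λ () ; walk = x~z , z~y , tt
                        ; distinct = (x≢z ∷ x≢y ∷ []) ∷ (z≢y ∷ []) ∷ [] ∷ [] }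
    ; shortest = walk-≁⇒3≤length x≢y x≁y
    }

  isometric-length≤ : ∀ {d} →
                      (∀ x y → ∃ λ q → IsWalk Adj q × head q ≡ just x × last q ≡ just y × length q ≤ d) →
                      ∀ {p} → IsIsometricPath Adj p → length p ≤ d
  isometric-length≤ short {[]}    _         = z≤n
  isometric-length≤ short {x ∷ p} isometric =
    let y , lastₚ = last-∷ x p
        q , walk , headq , lastq , q≤d = short x y
    in ≤-trans (IsIsometricPath.shortest isometric q walk headq (trans lastq (sym lastₚ))) q≤d

length-concat-≤ : ∀ {d} {ps : List (List A)} → All (λ p → length p ≤ d) ps → length (concat ps) ≤ d * length ps
length-concat-≤ {ps = []}     []         = z≤n
length-concat-≤ {d = d} {ps = p ∷ ps} (p≤d ∷ ps≤d) = begin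
  length (p ++ concat ps)        ≡⟨ length-++ p ⟩
  length p + length (concat ps)  ≤⟨ +-mono-≤ p≤d (length-concat-≤ ps≤d) ⟩
  d + d * length ps              ≡⟨ *-suc d (length ps) ⟨
  d * suc (length ps)            ∎
  where open ≤-Reasoning

injective⇒≤length : ∀ {n} (f : Fin n → A) → Injective _≡_ _≡_ f → (xs : List A) → (∀ x → x ∈ xs) →
                    n ≤ length xs
injective⇒≤length f f-injective xs complete =
  injective⇒≤ (f-injective ∘ index-injective (setoid _) (complete _) (complete _))

-- Complete multipartite graphs

shiftPart : {s : Fin (suc R) → ℕ} → KVertex R (s ∘ suc) → KVertex (suc R) s
shiftPart (i , a) = suc i , a

shiftPart-injective : {s : Fin (suc R) → ℕ} → Injective _≡_ _≡_ (shiftPart {s = s})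
shiftPart-injective {x = _ , _} {_ , _} refl = refl

enumerate : ∀ R (s : Fin R → ℕ) → Fin (totalSize R s) → KVertex R s
enumerate (suc R) s k = [ (zero ,_) , shiftPart ∘ enumerate R (s ∘ suc) ]′ (splitAt (s zero) k)

enumerate-injective : ∀ R (s : Fin R → ℕ) → Injective _≡_ _≡_ (enumerate R s)
enumerate-injective (suc R) s {k} {l} eq = begin
  k                   ≡⟨ join-splitAt (s zero) _ k ⟨
  join _ _ (split k)  ≡⟨ cong (join _ _) (place-injective (split k) (split l) eq) ⟩
  join _ _ (split l)  ≡⟨ join-splitAt (s zero) _ l ⟩
  l                   ∎
  where
  split : Fin (totalSize (suc R) s) → Fin (s zero) ⊎ Fin (totalSize R (s ∘ suc))
  split = splitAt (s zero)
  open ≡-Reasoning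
  place : Fin (s zero) ⊎ Fin (totalSize R (s ∘ suc)) → KVertex (suc R) s
  place = [ (zero ,_) , shiftPart ∘ enumerate R (s ∘ suc) ]′
  place-injective : ∀ u v → place u ≡ place v → u ≡ v
  place-injective (inj₁ a) (inj₁ b) refl = refl
  place-injective (inj₂ a) (inj₂ b) eq   = cong inj₂ (enumerate-injective R (s ∘ suc) (shiftPart-injective eq))

module Multipartite {r′ : ℕ} (sizes : Fin (suc r′) → ℕ)
                    (another : ∀ i → Σ (KVertex (suc r′) sizes) λ z → proj₁ z ≢ i) where

  private
    r : ℕ
    r = suc r′
    Vertex : Set
    Vertex = KVertex r sizes
    Adj : Vertex → Vertex → Set
    Adj = KAdj r sizes

  part-≢⇒≢ : {x y : Vertex} → proj₁ x ≢ proj₁ y → x ≢ y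
  part-≢⇒≢ parts≢ refl = parts≢ refl

  geodesic-through-part : {x z y : Vertex} → proj₁ x ≡ proj₁ y → x ≢ y → proj₁ z ≢ proj₁ x →
                          IsIsometricPath Adj (x ∷ z ∷ y ∷ [])
  geodesic-through-part {x} {z} {y} x∼y x≢y z≁x =
    geodesic-isometric (z≁x ∘ sym) z≁y (part-≢⇒≢ (z≁x ∘ sym)) (part-≢⇒≢ z≁y) x≢y (λ x≁y → x≁y x∼y)
    where
    z≁y : proj₁ z ≢ proj₁ y
    z≁y z∼y = z≁x (trans z∼y (sym x∼y))

  short-walk : ∀ x y → ∃ λ q → IsWalk Adj q × head q ≡ just x × last q ≡ just y × length q ≤ 3
  short-walk x y with proj₁ x ≟ proj₁ y
  ... | no x≁y  = x ∷ y ∷ [] , (x≁y , tt) , refl , refl , s≤s (s≤s z≤n)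
  ... | yes x∼y =
    let z , z≁x = another (proj₁ x)
    in x ∷ z ∷ y ∷ [] , (z≁x ∘ sym , (λ z∼y → z≁x (trans z∼y (sym x∼y))) , tt) , refl , refl , ≤-refl

  common-isometric-path : (x y : Vertex) → ∃ λ p → IsIsometricPath Adj p × x ∈ p × y ∈ p
  common-isometric-path x y with ≡-dec _≟_ _≟_ x y | proj₁ x ≟ proj₁ y
  ... | yes refl | _        = x ∷ [] , singleton-isometric x , here refl , here refl
  ... | no x≢y   | no x≁y   = x ∷ y ∷ [] , edge-isometric x≢y x≁y , here refl , there (here refl)
  ... | no x≢y   | yes x∼y  =
    let z , z≁x = another (proj₁ x)
    in x ∷ z ∷ y ∷ [] , geodesic-through-part x∼y x≢y z≁x , here refl , there (there (here refl))

  vertices≤3*paths : ∀ {k} → IsometricPathCover Adj k → totalSize r sizes ≤ 3 * k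
  vertices≤3*paths (ps , refl , isometric , covered) = ≤-trans
    (injective⇒≤length (enumerate r sizes) (enumerate-injective r sizes) (concat ps) (∈-concat⁺ ∘ covered))
    (length-concat-≤ (All.map (isometric-length≤ short-walk) isometric))

  -- The uncovered vertices of part k are those of index below c k, so removeTop k c covers the one of
  -- index c k ∸ 1.
  Remaining : (Fin r → ℕ) → Vertex → Set
  Remaining c (k , a) = toℕ a < c k

  Bounded : (Fin r → ℕ) → Set
  Bounded c = ∀ k → c k ≤ sizes k

  PartialCover : (Fin r → ℕ) → ℕ → Set
  PartialCover c n = Σ (List (List Vertex)) λ ps →
    length ps ≡ n × All (IsIsometricPath Adj) ps × (∀ v → Remaining c v → Any (v ∈_) ps)

  bounded-removeTop : ∀ {c} (k : Fin r) → Bounded c → Bounded (removeTop k c)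
  bounded-removeTop {c} k bounded l = ≤-trans (removeTop-≤ k c l) (bounded l)

  no-remaining : ∀ {c v} → totalSize r c ≡ 0 → ¬ Remaining c v
  no-remaining {c} {k , _} c≡0 a<cₖ = n≮0 (<-≤-trans a<cₖ (subst (c k ≤_) c≡0 (entry≤totalSize c k)))

  module _ {c : Fin r → ℕ} (bounded : Bounded c) (k : Fin r) {m : ℕ} (cₖ : c k ≡ suc m) where

    top : Vertex
    top = k , fromℕ< (subst (_≤ sizes k) cₖ (bounded k))

    top-remaining : Remaining c top
    top-remaining = subst₂ _<_ (sym (toℕ-fromℕ< _)) (sym cₖ) ≤-refl

    top-removed : ¬ Remaining (removeTop k c) top
    top-removed = <-irrefl refl ∘ subst₂ _<_ (toℕ-fromℕ< _) (removeTop-at k c cₖ)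

    remaining-removeTop : ∀ {v} → Remaining c v → v ≡ top ⊎ Remaining (removeTop k c) v
    remaining-removeTop {l , a} a<cₗ with l ≟ k
    ... | no l≢k = inj₂ (subst (toℕ a <_) (sym (removeTop-other k c l≢k)) a<cₗ)
    ... | yes refl with m≤n⇒m<n∨m≡n (≤-pred (subst (toℕ a <_) cₖ a<cₗ))
    ...   | inj₁ a<m = inj₂ (subst (toℕ a <_) (sym (removeTop-at k c cₖ)) a<m)
    ...   | inj₂ a≡m = inj₁ (cong (k ,_) (toℕ-injective (trans a≡m (sym (toℕ-fromℕ< _)))))

  peel : ∀ {n} (c : Fin r → ℕ) → Bounded c → totalSize r c ≡ suc n →
         Σ Vertex λ x → Σ (Fin r → ℕ) λ c′ →
           Bounded c′ × totalSize r c′ ≡ n × (∀ {v} → Remaining c v → v ≡ x ⊎ Remaining c′ v)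
  peel c bounded c≡1+n with positive-entry c (subst (0 <_) (sym c≡1+n) z<s)
  ... | k , m , cₖ = top bounded k cₖ , removeTop k c , bounded-removeTop k bounded ,
                     suc-injective (trans (totalSize-removeTop k c cₖ) c≡1+n) , remaining-removeTop bounded k cₖ

  single-path-cover : ∀ {c} (x y : Vertex) → (∀ {v} → Remaining c v → v ≡ x ⊎ v ≡ y) → PartialCover c 1
  single-path-cover x y only with common-isometric-path x y
  ... | p , isometric , x∈p , y∈p =
    p ∷ [] , refl , isometric ∷ [] , λ v r → here ([ (λ { refl → x∈p }) , (λ { refl → y∈p }) ]′ (only r))

  small-cover : ∀ {e} (c : Fin r → ℕ) → e ≤ 2 → Bounded c → totalSize r c ≡ e → PartialCover c (ceilDiv3 e)
  small-cover c z≤n _ c≡0 = [] , refl , [] , λ _ r → ⊥-elim (no-remaining {c} c≡0 r)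
  small-cover c (s≤s z≤n) bounded c≡1 =
    let x , c′ , _ , c′≡0 , split = peel c bounded c≡1
    in single-path-cover {c} x x ([ inj₁ , ⊥-elim ∘ no-remaining {c′} c′≡0 ]′ ∘ split)
  small-cover c (s≤s (s≤s z≤n)) bounded c≡2 =
    let x , c′ , bounded′ , c′≡1 , split  = peel c bounded c≡2
        y , c″ , _        , c″≡0 , split′ = peel c′ bounded′ c′≡1
    in single-path-cover {c} x y ([ inj₁ , [ inj₂ , ⊥-elim ∘ no-remaining {c″} c″≡0 ]′ ∘ split′ ]′ ∘ split)

  extend : ∀ {c n} → Bounded c → (choice : Choice c) → PartialCover (Step.c₃ choice) n → PartialCover c (suc n)
  extend {c} bounded choice (ps , length≡n , isometric , covered) =
    (x ∷ z ∷ y ∷ []) ∷ ps , cong suc length≡n , geodesic-through-part refl x≢y j≢i ∷ isometric , covered′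
    where
    open Choice choice
    open Step choice
    bounded₁ : Bounded c₁
    bounded₁ = bounded-removeTop i bounded
    bounded₂ : Bounded c₂
    bounded₂ = bounded-removeTop i bounded₁
    x y z : Vertex
    x = top bounded  i cᵢ
    y = top bounded₁ i c₁ᵢ
    z = top bounded₂ j c₂ⱼ
    x≢y : x ≢ y
    x≢y x≡y = top-removed bounded i cᵢ (subst (Remaining c₁) (sym x≡y) (top-remaining bounded₁ i c₁ᵢ))
    covered′ : ∀ v → Remaining c v → Any (v ∈_) ((x ∷ z ∷ y ∷ []) ∷ ps)
    covered′ v r with remaining-removeTop bounded i cᵢ r
    ... | inj₁ refl = here (here refl)
    ... | inj₂ r₁ with remaining-removeTop bounded₁ i c₁ᵢ r₁
    ...   | inj₁ refl = here (there (there (here refl)))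
    ...   | inj₂ r₂ with remaining-removeTop bounded₂ j c₂ⱼ r₂
    ...     | inj₁ refl = here (there (here refl))
    ...     | inj₂ r₃   = there (covered v r₃)

  greedy-cover : ∀ t {e} → e ≤ 2 → (c : Fin r → ℕ) → Bounded c → totalSize r c ≡ 3 * t + e → Balanced t c →
                 PartialCover c (ceilDiv3 (totalSize r c))
  greedy-cover zero e≤2 c bounded c≡e _ =
    subst (PartialCover c ∘ ceilDiv3) (sym c≡e) (small-cover c e≤2 bounded c≡e)
  greedy-cover (suc t) {e} e≤2 c bounded c≡3t+3+e balanced =
    subst (PartialCover c) ceilDiv3-c
      (extend bounded choice (greedy-cover t e≤2 c₃ bounded₃ c₃≡3t+e (balanced-c₃ balanced 3t≤c₃)))
    where
    choice : Choice c
    choice = choose balanced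
    open Step choice
    bounded₃ : Bounded c₃
    bounded₃ k = ≤-trans (c₃≤c k) (bounded k)
    c₃≡3t+e : totalSize r c₃ ≡ 3 * t + e
    c₃≡3t+e = +-cancelˡ-≡ 3 _ _ (trans totalSize-c₃ (trans c≡3t+3+e (regroup t e)))
      where
      regroup : ∀ t e → 3 * suc t + e ≡ 3 + (3 * t + e)
      regroup = solve-∀
    3t≤c₃ : 3 * t ≤ totalSize r c₃
    3t≤c₃ = subst (3 * t ≤_) (sym c₃≡3t+e) (m≤m+n _ _)
    ceilDiv3-c : suc (ceilDiv3 (totalSize r c₃)) ≡ ceilDiv3 (totalSize r c)
    ceilDiv3-c = trans (sym (ceilDiv3-3+ (totalSize r c₃))) (cong ceilDiv3 totalSize-c₃)

  cover-by-ceilDiv3 : Balanced (totalSize r sizes / 3) sizes →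
                      IsometricPathCover Adj (ceilDiv3 (totalSize r sizes))
  cover-by-ceilDiv3 balanced =
    covers-all (greedy-cover (n / 3) (≤-pred (m%n<n n 3)) sizes (λ _ → ≤-refl) (n≡3*[n/3]+n%3 n) balanced)
    where
    n : ℕ
    n = totalSize r sizes
    covers-all : PartialCover sizes (ceilDiv3 n) → IsometricPathCover Adj (ceilDiv3 n)
    covers-all (ps , length≡ , isometric , covered) =
      ps , length≡ , isometric , λ v → covered v (toℕ<n (proj₂ v))

another-part : ∀ {r′} → 1 ≤ r′ → {sizes : Fin (suc r′) → ℕ} → (∀ i → 1 ≤ sizes i) →
               ∀ i → Σ (KVertex (suc r′) sizes) λ z → proj₁ z ≢ i
another-part (s≤s _) nonempty zero    = (suc zero , fromℕ< (nonempty (suc zero))) , λ ()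
another-part _       nonempty (suc i) = (zero , fromℕ< (nonempty zero)) , λ ()

lemma3 : (r′ : ℕ) → 1 ≤ r′ → (sizes : Fin (suc r′) → ℕ) →
         (∀ (i j : Fin (suc r′)) → i F.≤ j → sizes j ≤ sizes i) →
         (∀ (i : Fin (suc r′)) → 1 ≤ sizes i) →
         3 * sizes zero ≤ 2 * totalSize (suc r′) sizes →
         3 * oddCount (suc r′) sizes ≤ totalSize (suc r′) sizes →
         IsometricPathNumber (KAdj (suc r′) sizes) (ceilDiv3 (totalSize (suc r′) sizes))
lemma3 r′ 1≤r′ sizes antitone nonempty 3n₁≤2n 3α≤n =
  cover-by-ceilDiv3 (balanced-initial sizes 3nₖ≤2n 3α≤n′) , λ _ cover → ceilDiv3-least (vertices≤3*paths cover)
  where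
  open Multipartite sizes (another-part 1≤r′ nonempty)
  3nₖ≤2n : ∀ k → 3 * sizes k ≤ 2 * totalSize (suc r′) sizes
  3nₖ≤2n k = ≤-trans (*-monoʳ-≤ 3 (antitone zero k z≤n)) 3n₁≤2n
  3α≤n′ : 3 * oddParts sizes ≤ totalSize (suc r′) sizes
  3α≤n′ = subst (λ α → 3 * α ≤ totalSize (suc r′) sizes) (oddCount≡oddParts sizes) 3α≤n
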